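{- Let $\mathcal{M}$ be a unitary magma. The set $\mathcal{T}_\mathcal{M}$ of all $\mathcal{M}$-cliques of size $2$ (the $\mathcal{M}$-triangles) is the unique minimal generating set of the operad $\mathrm{NC}\mathcal{M}$.
   Context: A unitary magma is a set $\mathcal{M}$ with a binary operation $\star$ admitting a two-sided unit $\mathds{1}_\mathcal{M}$. For $n\geq 1$, an $\mathcal{M}$-clique of size $n$ is a complete graph $\mathfrak{p}$ on the vertex set $[n+1]$ with a labeling of each arc $(x,y)$, $1\le x<y\le n+1$, by $\mathfrak{p}(x,y)\in\mathcal{M}$; $(1,n+1)$ is the base, $(i,i+1)$ ($1\le i\le n$) is the $i$-th edge, and all other arcs are diagonals. An arc is solid if its label is not $\mathds{1}_\mathcal{M}$. Two diagonals $(x,y),(x',y')$ cross if $x<x'<y<y'$ or $x'<x<y'<y$. The operad $\mathrm{C}\mathcal{M}=\bigoplus_{n\ge1}\mathrm{C}\mathcal{M}(n)$ over a field of characteristic zero has $\mathrm{C}\mathcal{M}(1)$ spanned by the clique $\mathbf{u}$ of size 1 with base labeled $\mathds{1}_\mathcal{M}$ (the unit) and $\mathrm{C}\mathcal{M}(n)$, $n\ge2$, with basis all $\mathcal{M}$-cliques of size $n$. For $\mathfrak{p}$ of size $n$, $\mathfrak{q}$ of size $m$, $i\in[n]$, $\mathfrak{p}\circ_i\mathfrak{q}$ is the $\mathcal{M}$-clique of size $n+m-1$ obtained by gluing the base of $\mathfrak{q}$ onto the $i$-th edge of $\mathfrak{p}$: vertex $x$ of $\mathfrak{p}$ becomes $x$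 if $x\le i$ and $x+m-1$ if $x\ge i+1$, vertex $y$ of $\mathfrak{q}$ becomes $y+i-1$; arcs of $\mathfrak{p}$ other than its $i$-th edge and arcs of $\mathfrak{q}$ other than its base keep their labels, the arc $(i,i+m)$ gets label $\mathfrak{p}(i,i+1)\star\mathfrak{q}(1,m+1)$, and all other arcs get $\mathds{1}_\mathcal{M}$; extended bilinearly. $\mathrm{NC}\mathcal{M}$ is the suboperad of $\mathrm{C}\mathcal{M}$ spanned by $\mathbf{u}$ and all $\mathcal{M}$-cliques having no two crossing solid diagonals ($\mathcal{M}$-noncrossing configurations). -}

module Defs where

open import Data.Nat using (ℕ; zero; suc; _+_; _∸_; _≤_; _<_; _≤ᵇ_; _≡ᵇ_)
open import Data.Fin using (Fin; toℕ)
open import Data.Vec using (Vec; []; _∷_; tabulate)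
open import Data.Product using (_×_; _,_)
open import Data.Sum using (_⊎_)
open import Data.Unit using (⊤; tt)
open import Data.Bool using (Bool; true; false; _∧_; _∨_; if_then_else_)
open import Relation.Nullary using (¬_)
open import Relation.Binary.PropositionalEquality using (_≡_)

-- Cliques over a unitary magma (M, _⋆_, 𝟙).  The unit laws are assumed
-- in the theorem statement; they are not needed to *define* anything.
module Cliques (M : Set) (_⋆_ : M → M → M) (𝟙 : M) where

  -- Tri v : the labels of all arcs (x , y), x < y, of a complete graph on
  -- v vertices (0-based internally): the labels of the arcs out of the
  -- first vertex, followed by the triangle on the remaining vertices.
  -- This is a canonical (first-order) representation, so _≡_ on it is
  -- equality of labelled complete graphs.
  Tri : ℕ → Set
  Tri zero = ⊤
  Tri (suc v) = Vec M v × Tri v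

  lookupℕ : ∀ {k} → Vec M k → ℕ → M
  lookupℕ [] _ = 𝟙
  lookupℕ (a ∷ as) zero = a
  lookupℕ (a ∷ as) (suc j) = lookupℕ as j

  get0 : ∀ {v} → Tri v → ℕ → ℕ → M
  get0 {zero} _ _ _ = 𝟙
  get0 {suc v} (row , rest) zero zero = 𝟙
  get0 {suc v} (row , rest) zero (suc y) = lookupℕ row y
  get0 {suc v} (row , rest) (suc x) zero = 𝟙
  get0 {suc v} (row , rest) (suc x) (suc y) = get0 rest x y

  build0 : (v : ℕ) → (ℕ → ℕ → M) → Tri v
  build0 zero f = tt
  build0 (suc v) f =
    tabulate (λ j → f zero (suc (toℕ j))) , build0 v (λ x y → f (suc x) (suc y))

  -- An M-clique of size n: complete graph on the vertex set [n+1] = {1,…,n+1}.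
  Clique : ℕ → Set
  Clique n = Tri (suc n)

  -- label p(x , y) of the arc (x , y), vertices 1-based, 1 ≤ x < y ≤ n+1
  -- (value 𝟙 outside that range, irrelevant)
  lab : ∀ {n} → Clique n → ℕ → ℕ → M
  lab p (suc x) (suc y) = get0 p x y
  lab p _ _ = 𝟙

  fromLabels : (n : ℕ) → (ℕ → ℕ → M) → Clique n
  fromLabels n f = build0 (suc n) (λ x y → f (suc x) (suc y))

  u : Clique 1
  u = fromLabels 1 (λ _ _ → 𝟙)

  -- partial composition p ∘ᵢ q  (p of size n, q of size m, 1 ≤ i ≤ n),
  -- a clique of size n + m - 1, exactly as in the paper:
  --  * the arc (i , i+m) gets p(i , i+1) ⋆ q(1 , m+1);
  --  * an arc with both ends in the image {i,…,i+m} of q gets the label of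
  --    the corresponding arc of q (vertex y of q ↦ y + i - 1);
  --  * an arc with both ends in the image {1,…,i} ∪ {i+m,…,n+m} of p gets
  --    the label of the corresponding arc of p (x ↦ x if x ≤ i, x+m-1 else);
  --  * all other arcs get 𝟙.
  compose : ∀ {n m} → Clique n → ℕ → Clique m → Clique (n + m ∸ 1)
  compose {n} {m} p i q = fromLabels (n + m ∸ 1) f
    where
      inQ : ℕ → Bool
      inQ x = (i ≤ᵇ x) ∧ (x ≤ᵇ (i + m))
      inP : ℕ → Bool
      inP x = (x ≤ᵇ i) ∨ ((i + m) ≤ᵇ x)
      preP : ℕ → ℕ
      preP x = if x ≤ᵇ i then x else x ∸ (m ∸ 1)
      preQ : ℕ → ℕ
      preQ x = suc (x ∸ i)
      f : ℕ → ℕ → M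
      f x y =
        if (x ≡ᵇ i) ∧ (y ≡ᵇ (i + m)) then lab p i (suc i) ⋆ lab q 1 (suc m)
        else if inQ x ∧ inQ y then lab q (preQ x) (preQ y)
        else if inP x ∧ inP y then lab p (preP x) (preP y)
        else 𝟙

  IsArc : ℕ → ℕ → ℕ → Set
  IsArc n x y = 1 ≤ x × x < y × y ≤ suc n

  IsDiagonal : ℕ → ℕ → ℕ → Set
  IsDiagonal n x y = IsArc n x y × ¬ (y ≡ suc x) × ¬ ((x ≡ 1) × (y ≡ suc n))

  Crosses : ℕ → ℕ → ℕ → ℕ → Set
  Crosses x y x' y' = (x < x' × x' < y × y < y') ⊎ (x' < x × x < y' × y' < y)

  -- an arc is solid iff its label differs from 𝟙; "no two crossing solid
  -- diagonals" is rendered constructively as: of any two crossing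
  -- diagonals at least one is non-solid.
  NonCrossing : (n : ℕ) → Clique n → Set
  NonCrossing n p = ∀ x y x' y' → IsDiagonal n x y → IsDiagonal n x' y' →
    Crosses x y x' y' → (lab p x y ≡ 𝟙) ⊎ (lab p x' y' ≡ 𝟙)

  -- the basis of NCM: u in arity 1, all M-noncrossing configurations in
  -- arities n ≥ 2
  NCBasis : (n : ℕ) → Clique n → Set
  NCBasis n p = (1 ≤ n) × ((n ≡ 1) → lab p 1 2 ≡ 𝟙) × NonCrossing n p

  Family : Set₁
  Family = (n : ℕ) → Clique n → Set

  _⊆_ : Family → Family → Set
  G ⊆ H = ∀ n p → G n p → H n p

  data Generated (G : Family) : Family where
    unit : Generated G 1 u
    gen  : ∀ {n p} → G n p → Generated G n p
    comp : ∀ {n m p q} (i : ℕ) → 1 ≤ i → i ≤ n →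
           Generated G n p → Generated G m q →
           Generated G (n + m ∸ 1) (compose p i q)

  IsGeneratingSet : Family → Set
  IsGeneratingSet G = (G ⊆ NCBasis) × (NCBasis ⊆ Generated G)

  IsMinimalGeneratingSet : Family → Set₁
  IsMinimalGeneratingSet G =
    IsGeneratingSet G × (∀ H → H ⊆ G → IsGeneratingSet H → G ⊆ H)

  IsUniqueMinimalGeneratingSet : Family → Set₁
  IsUniqueMinimalGeneratingSet T =
    IsMinimalGeneratingSet T ×
    (∀ G → IsMinimalGeneratingSet G → (G ⊆ T) × (T ⊆ G))

  Triangles : Family
  Triangles n p = n ≡ 2

-- A noncrossing configuration p of size n ≥ 3 has an "ear": a
-- vertex v ∈ {2,…,n} all of whose incident diagonals are non-solid.  Such an
-- ear lets us write p = q ∘ᵢ t (i = v - 1), where q is p with vertex v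
-- deleted (again noncrossing, of size n - 1) and t is the triangle on the
-- vertices i, i+1, i+2 of p; induction on n finishes.  To find an ear we pick,
-- inside the frame spanned by the base or by a possibly-solid diagonal (a,b),
-- the vertex a+1: either it is an ear, or a possibly-solid diagonal
-- (a+1, z) gives a strictly smaller frame.  Because noncrossingness is a
-- disjunction and M-labels need not have decidable equality, "possibly solid"
-- is a decidable, pairwise noncrossing family extracted from the
-- noncrossingness witness itself.
--
-- Compositions landing in arity ≤ 2 only involve
-- the unit u, so every generating set must contain each triangle itself.
-- This gives minimality, and a minimal generating set G equals the triangles
-- because G ∩ Triangles still generates.

module Submission where

open import Defs
open import Algebra.Structures using (IsUnitalMagma)
open import Relation.Binary.PropositionalEquality
open import Data.Nat
open import Data.Nat.Properties
open import Data.Fin using (toℕ)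
open import Data.Vec using (Vec; []; _∷_; tabulate)
open import Data.Product using (_×_; _,_; proj₁; proj₂; ∃)
open import Data.Sum using (_⊎_; inj₁; inj₂; map₂; swap) renaming (map to ⊎-map)
open import Data.Unit using (⊤; tt)
open import Data.Empty using (⊥; ⊥-elim)
open import Data.Bool using (Bool; true; false; _∧_; _∨_; if_then_else_)
open import Data.Bool.Properties using (∧-zeroʳ; ∨-zeroʳ) renaming (_≟_ to _≟ᵇ_)
open import Relation.Nullary
open import Relation.Binary.Definitions using (tri<; tri≈; tri>)
open import Relation.Nullary.Decidable using (dec-true; dec-false; decidable-stable; _×-dec_; _⊎-dec_; ¬?)

≤ᵇ-true : ∀ {m n} → m ≤ n → (m ≤ᵇ n) ≡ true
≤ᵇ-true {m} {n} = dec-true (m ≤? n)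

≤ᵇ-false : ∀ {m n} → n < m → (m ≤ᵇ n) ≡ false
≤ᵇ-false {m} {n} n<m = dec-false (m ≤? n) (<⇒≱ n<m)

≡ᵇ-true : ∀ {m n} → m ≡ n → (m ≡ᵇ n) ≡ true
≡ᵇ-true {m} {n} = dec-true (m ≟ n)

≡ᵇ-false : ∀ {m n} → m ≢ n → (m ≡ᵇ n) ≡ false
≡ᵇ-false {m} {n} = dec-false (m ≟ n)

∧-falseʳ : ∀ a {b} → b ≡ false → a ∧ b ≡ false
∧-falseʳ a refl = ∧-zeroʳ a

module Development (M : Set) (_⋆_ : M → M → M) (𝟙 : M) where
  open Cliques M _⋆_ 𝟙

  lookup-tabulate : ∀ {k} (g : ℕ → M) j → j < k →
    lookupℕ (tabulate {n = k} (λ j → g (toℕ j))) j ≡ g j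
  lookup-tabulate {suc k} g zero    _         = refl
  lookup-tabulate {suc k} g (suc j) (s≤s j<k) = lookup-tabulate (λ j → g (suc j)) j j<k

  get0-build0 : ∀ v f {x y} → x < y → y < v → get0 (build0 v f) x y ≡ f x y
  get0-build0 (suc v) f {zero}  {suc y} _         (s≤s y<v) = lookup-tabulate (λ j → f zero (suc j)) y y<v
  get0-build0 (suc v) f {suc x} {suc y} (s≤s x<y) (s≤s y<v) =
    get0-build0 v (λ x y → f (suc x) (suc y)) x<y y<v

  lab-fromLabels : ∀ n f {x y} → IsArc n x y → lab (fromLabels n f) x y ≡ f x y
  lab-fromLabels n f {suc x} {suc y} (_ , s≤s x<y , y≤) =
    get0-build0 (suc n) (λ x y → f (suc x) (suc y)) x<y y≤

  lookup-ext : ∀ {k} (a b : Vec M k) → (∀ j → j < k → lookupℕ a j ≡ lookupℕ b j) → a ≡ b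
  lookup-ext []       []       _  = refl
  lookup-ext (a ∷ as) (b ∷ bs) eq =
    cong₂ _∷_ (eq zero z<s) (lookup-ext as bs (λ j j<k → eq (suc j) (s≤s j<k)))

  get0-ext : ∀ v (p q : Tri v) → (∀ x y → x < y → y < v → get0 p x y ≡ get0 q x y) → p ≡ q
  get0-ext zero    tt         tt         _  = refl
  get0-ext (suc v) (r₁ , t₁) (r₂ , t₂) eq =
    cong₂ _,_ (lookup-ext r₁ r₂ (λ j j<v → eq zero (suc j) z<s (s≤s j<v)))
              (get0-ext v t₁ t₂ (λ x y x<y y<v → eq (suc x) (suc y) (s≤s x<y) (s≤s y<v)))

  clique-ext : ∀ n (p q : Clique n) → (∀ x y → IsArc n x y → lab p x y ≡ lab q x y) → p ≡ q
  clique-ext n p q eq = get0-ext (suc n) p q (λ x y x<y y≤ → eq (suc x) (suc y) (s≤s z≤n , s≤s x<y , y≤))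

  generated-relabel : ∀ {G a b} {r : Clique a} → Generated G a r → a ≡ b → (p : Clique b) →
    (∀ x y → IsArc b x y → lab r x y ≡ lab p x y) → Generated G b p
  generated-relabel {r = r} g refl p eq = subst (Generated _ _) (clique-ext _ r p eq) g

  inQ : ℕ → ℕ → ℕ → Bool
  inQ i m x = (i ≤ᵇ x) ∧ (x ≤ᵇ (i + m))

  inP : ℕ → ℕ → ℕ → Bool
  inP i m x = (x ≤ᵇ i) ∨ ((i + m) ≤ᵇ x)

  preP : ℕ → ℕ → ℕ → ℕ
  preP i m x = if x ≤ᵇ i then x else x ∸ (m ∸ 1)

  ifChain : Bool → Bool → Bool → M → M → M → M
  ifChain r b c A B C = if r then A else if b then B else if c then C else 𝟙

  lab-compose : ∀ {n m} (p : Clique n) i (q : Clique m) {x y} → IsArc (n + m ∸ 1) x y →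
    lab (compose p i q) x y ≡
    ifChain ((x ≡ᵇ i) ∧ (y ≡ᵇ (i + m))) (inQ i m x ∧ inQ i m y) (inP i m x ∧ inP i m y)
            (lab p i (suc i) ⋆ lab q 1 (suc m)) (lab q (suc (x ∸ i)) (suc (y ∸ i)))
            (lab p (preP i m x) (preP i m y))
  lab-compose {n} {m} p i q = lab-fromLabels (n + m ∸ 1) λ x y →
    ifChain ((x ≡ᵇ i) ∧ (y ≡ᵇ (i + m))) (inQ i m x ∧ inQ i m y) (inP i m x ∧ inP i m y)
            (lab p i (suc i) ⋆ lab q 1 (suc m)) (lab q (suc (x ∸ i)) (suc (y ∸ i)))
            (lab p (preP i m x) (preP i m y))

  isRoot-false : ∀ i m x y → x ≢ i ⊎ y ≢ i + m → ((x ≡ᵇ i) ∧ (y ≡ᵇ (i + m))) ≡ false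
  isRoot-false i m x y (inj₁ x≢i) rewrite ≡ᵇ-false x≢i = refl
  isRoot-false i m x y (inj₂ y≢) = ∧-falseʳ (x ≡ᵇ i) (≡ᵇ-false y≢)

  inQ-true : ∀ i m x → i ≤ x → x ≤ i + m → inQ i m x ≡ true
  inQ-true i m x i≤x x≤ = cong₂ _∧_ (≤ᵇ-true i≤x) (≤ᵇ-true x≤)

  inQ-false : ∀ i m x → x < i ⊎ i + m < x → inQ i m x ≡ false
  inQ-false i m x (inj₁ x<i) rewrite ≤ᵇ-false x<i = refl
  inQ-false i m x (inj₂ <x) = ∧-falseʳ (i ≤ᵇ x) (≤ᵇ-false <x)

  inP-true : ∀ i m x → x ≤ i ⊎ i + m ≤ x → inP i m x ≡ true
  inP-true i m x (inj₁ x≤i) rewrite ≤ᵇ-true x≤i = refl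
  inP-true i m x (inj₂ ≤x) rewrite ≤ᵇ-true ≤x = ∨-zeroʳ (x ≤ᵇ i)

  inP-false : ∀ i m x → i < x → x < i + m → inP i m x ≡ false
  inP-false i m x i<x x< = cong₂ _∨_ (≤ᵇ-false i<x) (≤ᵇ-false x<)

  compose-root : ∀ {n m} (p : Clique n) i (q : Clique m) {y} → y ≡ i + m → IsArc (n + m ∸ 1) i y →
    lab (compose p i q) i y ≡ lab p i (suc i) ⋆ lab q 1 (suc m)
  compose-root p i q y≡ arc
    rewrite lab-compose p i q arc | ≡ᵇ-true {i} refl | ≡ᵇ-true y≡ = refl

  compose-inner : ∀ {n m} (p : Clique n) i (q : Clique m) {x y} → IsArc (n + m ∸ 1) x y →
    i ≤ x → y ≤ i + m → x ≢ i ⊎ y ≢ i + m →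
    lab (compose p i q) x y ≡ lab q (suc (x ∸ i)) (suc (y ∸ i))
  compose-inner {m = m} p i q {x} {y} arc@(_ , x<y , _) i≤x y≤ notRoot
    rewrite lab-compose p i q arc | isRoot-false i m x y notRoot
          | inQ-true i m x i≤x (≤-trans (<⇒≤ x<y) y≤) | inQ-true i m y (≤-trans i≤x (<⇒≤ x<y)) y≤ = refl

  compose-outer : ∀ {n m} (p : Clique n) i (q : Clique m) {x y} → IsArc (n + m ∸ 1) x y →
    x ≤ i ⊎ i + m ≤ x → y ≤ i ⊎ i + m ≤ y → x < i ⊎ i + m < y →
    lab (compose p i q) x y ≡ lab p (preP i m x) (preP i m y)
  compose-outer {m = m} p i q {x} {y} arc xP yP (inj₁ x<i)
    rewrite lab-compose p i q arc | isRoot-false i m x y (inj₁ (<⇒≢ x<i))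
          | inQ-false i m x (inj₁ x<i) | inP-true i m x xP | inP-true i m y yP = refl
  compose-outer {m = m} p i q {x} {y} arc xP yP (inj₂ <y)
    rewrite lab-compose p i q arc | isRoot-false i m x y (inj₂ (≢-sym (<⇒≢ <y)))
          | ∧-falseʳ (inQ i m x) (inQ-false i m y (inj₂ <y)) | inP-true i m x xP | inP-true i m y yP = refl

  compose-crossing : ∀ {n m} (p : Clique n) i (q : Clique m) {x y} → IsArc (n + m ∸ 1) x y →
    (x < i × i < y × y < i + m) ⊎ (i < x × x < i + m × i + m < y) → lab (compose p i q) x y ≡ 𝟙
  compose-crossing {m = m} p i q {x} {y} arc (inj₁ (x<i , i<y , y<))
    rewrite lab-compose p i q arc | isRoot-false i m x y (inj₁ (<⇒≢ x<i))
          | inQ-false i m x (inj₁ x<i) | ∧-falseʳ (inP i m x) (inP-false i m y i<y y<) = refl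
  compose-crossing {m = m} p i q {x} {y} arc (inj₂ (i<x , x< , <y))
    rewrite lab-compose p i q arc | isRoot-false i m x y (inj₂ (≢-sym (<⇒≢ <y)))
          | ∧-falseʳ (inQ i m x) (inQ-false i m y (inj₂ <y)) | inP-false i m x i<x x< = refl

  up : ℕ → ℕ → ℕ
  up i x = if x ≤ᵇ i then x else suc x

  up-≤ : ∀ {i x} → x ≤ i → up i x ≡ x
  up-≤ x≤i = cong (if_then _ else _) (≤ᵇ-true x≤i)

  up-> : ∀ {i x} → i < x → up i x ≡ suc x
  up-> i<x = cong (if_then _ else _) (≤ᵇ-false i<x)

  up-cases : ∀ i x → (x ≤ i × up i x ≡ x) ⊎ (i < x × up i x ≡ suc x)
  up-cases i x with x ≤? i
  ... | yes x≤i = inj₁ (x≤i , up-≤ x≤i)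
  ... | no x≰i = inj₂ (≰⇒> x≰i , up-> (≰⇒> x≰i))

  up-inflationary : ∀ i x → x ≤ up i x
  up-inflationary i x with up-cases i x
  ... | inj₁ (_ , e) = ≤-reflexive (sym e)
  ... | inj₂ (_ , e) = subst (x ≤_) (sym e) (n≤1+n x)

  up-bounded : ∀ i x → up i x ≤ suc x
  up-bounded i x with up-cases i x
  ... | inj₁ (_ , e) = subst (_≤ suc x) (sym e) (n≤1+n x)
  ... | inj₂ (_ , e) = ≤-reflexive e

  up-strict : ∀ i {x y} → x < y → up i x < up i y
  up-strict i {x} {y} x<y with up-cases i x | up-cases i y
  ... | inj₁ (_ , ex) | inj₁ (_ , ey) rewrite ex | ey = x<y
  ... | inj₁ (_ , ex) | inj₂ (_ , ey) rewrite ex | ey = m<n⇒m<1+n x<y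
  ... | inj₂ (i<x , _) | inj₁ (y≤i , _) = ⊥-elim (<⇒≱ (<-trans i<x x<y) y≤i)
  ... | inj₂ (_ , ex) | inj₂ (_ , ey) rewrite ex | ey = s≤s x<y

  up-reflects : ∀ i {x y} → up i x < up i y → x < y
  up-reflects i {x} {y} lt with <-cmp x y
  ... | tri< x<y _ _ = x<y
  ... | tri≈ _ refl _ = ⊥-elim (<-irrefl refl lt)
  ... | tri> _ _ y<x = ⊥-elim (<-asym lt (up-strict i y<x))

  up-diagonal : ∀ {k} i {x y} → IsDiagonal k x y → IsDiagonal (suc k) (up i x) (up i y)
  up-diagonal {k} i {x} {y} ((1≤x , x<y , y≤) , notEdge , notBase) =
    ( ≤-trans 1≤x (up-inflationary i x) , up-strict i x<y , ≤-trans (up-bounded i y) (s≤s y≤) )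
    , (λ e → notEdge (edge e)) , (λ (ex , ey) → notBase (base ex ey))
    where
      edge : up i y ≡ suc (up i x) → y ≡ suc x
      edge e with y ≟ suc x
      ... | yes y≡ = y≡
      ... | no y≢ = ⊥-elim (<-irrefl (sym e)
              (≤-<-trans (up-strict i (n<1+n x)) (up-strict i (≤∧≢⇒< x<y (≢-sym y≢)))))
      base : up i x ≡ 1 → up i y ≡ suc (suc k) → x ≡ 1 × y ≡ suc k
      base ex ey = ≤-antisym (subst (x ≤_) ex (up-inflationary i x)) 1≤x
                 , ≤-antisym y≤ (≤-pred (subst (_≤ suc y) ey (up-bounded i y)))

  up-crosses : ∀ i {x y x' y'} → Crosses x y x' y' → Crosses (up i x) (up i y) (up i x') (up i y')
  up-crosses i (inj₁ (a , b , c)) = inj₁ (up-strict i a , up-strict i b , up-strict i c)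
  up-crosses i (inj₂ (a , b , c)) = inj₂ (up-strict i a , up-strict i b , up-strict i c)

  deleteVertex : ∀ {k} → ℕ → Clique (suc k) → Clique k
  deleteVertex {k} i p = fromLabels k (λ x y → lab p (up i x) (up i y))

  lab-deleteVertex : ∀ {k} i (p : Clique (suc k)) {x y} → IsArc k x y →
    lab (deleteVertex i p) x y ≡ lab p (up i x) (up i y)
  lab-deleteVertex {k} i p = lab-fromLabels k (λ x y → lab p (up i x) (up i y))

  deleteVertex-noncrossing : ∀ {k} i (p : Clique (suc k)) →
    NonCrossing (suc k) p → NonCrossing k (deleteVertex i p)
  deleteVertex-noncrossing i p nc x y x' y' d d' c =
    ⊎-map (trans (lab-deleteVertex i p (proj₁ d))) (trans (lab-deleteVertex i p (proj₁ d')))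
      (nc _ _ _ _ (up-diagonal i d) (up-diagonal i d') (up-crosses i c))

  Ear : (n : ℕ) → Clique n → ℕ → Set
  Ear n p v = ∀ z → (IsDiagonal n v z → lab p v z ≡ 𝟙) × (IsDiagonal n z v → lab p z v ≡ 𝟙)

  -- The triangle with edges labelled e₁, e₂ and base labelled base
  -- (a size-2 clique lists the arcs (1,2), (1,3) and then (2,3)).
  triangle : M → M → M → Clique 2
  triangle e₁ e₂ base = (e₁ ∷ base ∷ []) , (e₂ ∷ []) , [] , tt

  data Side (i : ℕ) : ℕ → Set where
    before : ∀ {x} → x ≤ i → Side i x
    apex   : Side i (suc i)
    after  : ∀ {x} → i < x → Side i (suc x)

  side : ∀ i x → Side i x
  side i zero = before z≤n
  side i (suc x) with suc x ≤? i | x ≟ i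
  ... | yes x<i | _        = before x<i
  ... | no _    | yes refl = apex
  ... | no x≮i  | no x≢i   = after (≤∧≢⇒< (≤-pred (≰⇒> x≮i)) (≢-sym x≢i))

  -- Ear decomposition: if vertex i+1 of p is an ear, then p = q ∘ᵢ t where
  -- q deletes the vertex i+1 and t is the triangle on i, i+1, i+2 with base 𝟙.
  -- The root (i , i+2) of the composition gets q(i , i+1) ⋆ 𝟙 = p(i , i+2);
  -- this is the only place where a unit law (the right one) is used.
  module EarDecomposition (⋆-identityʳ : ∀ a → a ⋆ 𝟙 ≡ a) {k i} (p : Clique (suc k))
                          (1≤i : 1 ≤ i) (i≤k : i ≤ k) (ear : Ear (suc k) p (suc i)) where

    q : Clique k
    q = deleteVertex i p

    t : Clique 2
    t = triangle (lab p i (suc i)) (lab p (suc i) (suc (suc i))) 𝟙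

    arity : k + 2 ∸ 1 ≡ suc k
    arity = cong (_∸ 1) (+-comm k 2)

    i+2 : i + 2 ≡ suc (suc i)
    i+2 = +-comm i 2

    arc-compose : ∀ {x y} → IsArc (suc k) x y → IsArc (k + 2 ∸ 1) x y
    arc-compose {x} {y} = subst (λ n → IsArc n x y) (sym arity)

    InP : ℕ → Set
    InP x = x ≤ i ⊎ suc (suc i) ≤ x

    inP-compose : ∀ {x} → InP x → x ≤ i ⊎ i + 2 ≤ x
    inP-compose {x} = map₂ (subst (_≤ x) (sym i+2))

    up-preP : ∀ {x} → InP x → up i (preP i 2 x) ≡ x
    up-preP {x} (inj₁ x≤i) rewrite ≤ᵇ-true x≤i = up-≤ x≤i
    up-preP {suc x} (inj₂ (s≤s i<x)) rewrite ≤ᵇ-false {suc x} (m<n⇒m<1+n i<x) = up-> i<x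

    arc-preP : ∀ {x y} → IsArc (suc k) x y → InP x → InP y → IsArc k (preP i 2 x) (preP i 2 y)
    arc-preP {x} {y} (1≤x , x<y , y≤) xP yP =
        up-reflects i (subst₂ _<_ (sym (up-≤ {i} z≤n)) (sym (up-preP xP)) 1≤x)
      , up-reflects i (subst₂ _<_ (sym (up-preP xP)) (sym (up-preP yP)) x<y)
      , ≤-pred (up-reflects i (subst₂ _<_ (sym (up-preP yP)) (sym (up-> (m<n⇒m<1+n (s≤s i≤k)))) (s≤s y≤)))

    outer : ∀ {x y} → IsArc (suc k) x y → InP x → InP y → x < i ⊎ suc (suc i) < y →
      lab (compose q i t) x y ≡ lab p x y
    outer {x} {y} arc xP yP separated = begin
      lab (compose q i t) x y
        ≡⟨ compose-outer q i t (arc-compose arc) (inP-compose xP) (inP-compose yP)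
                         (map₂ (subst (_< y) (sym i+2)) separated) ⟩
      lab q (preP i 2 x) (preP i 2 y)
        ≡⟨ lab-deleteVertex i p (arc-preP arc xP yP) ⟩
      lab p (up i (preP i 2 x)) (up i (preP i 2 y))
        ≡⟨ cong₂ (lab p) (up-preP xP) (up-preP yP) ⟩
      lab p x y ∎
      where open ≡-Reasoning

    ear-before : ∀ {x} → 1 ≤ x → x < i → lab p x (suc i) ≡ 𝟙
    ear-before 1≤x x<i = proj₂ (ear _)
      ( (1≤x , m<n⇒m<1+n x<i , s≤s (m≤n⇒m≤1+n i≤k))
      , (λ e → <-irrefl (sym (suc-injective e)) x<i)
      , (λ (_ , e) → <-irrefl (suc-injective e) (s≤s i≤k)) )

    ear-after : ∀ {y} → suc i < y → suc y ≤ suc (suc k) → lab p (suc i) (suc y) ≡ 𝟙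
    ear-after i+1<y y≤ = proj₁ (ear _)
      ( (s≤s z≤n , s≤s (<⇒≤ i+1<y) , y≤)
      , (λ e → <-irrefl (sym (suc-injective e)) i+1<y)
      , (λ (e , _) → <-irrefl (sym (suc-injective e)) 1≤i) )

    decomposition : ∀ x y → IsArc (suc k) x y → lab (compose q i t) x y ≡ lab p x y
    decomposition x y arc@(1≤x , x<y , y≤) with side i x | side i y
    ... | before x≤i | before y≤i = outer arc (inj₁ x≤i) (inj₁ y≤i) (inj₁ (<-≤-trans x<y y≤i))
    ... | before x≤i | apex with m≤n⇒m<n∨m≡n x≤i
    ...   | inj₁ x<i = trans (compose-crossing q i t (arc-compose arc)
                               (inj₁ (x<i , n<1+n i , subst (suc i <_) (sym i+2) (n<1+n (suc i)))))
                             (sym (ear-before 1≤x x<i))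
    ...   | inj₂ refl rewrite compose-inner q i t (arc-compose arc) ≤-refl
                                            (subst (suc i ≤_) (sym i+2) (n≤1+n (suc i)))
                                            (inj₂ (λ e → <-irrefl e (subst (suc i <_) (sym i+2) (n<1+n (suc i)))))
                            | n∸n≡0 i | m+n∸n≡m 1 i = refl
    decomposition x y arc@(1≤x , x<y , y≤) | before x≤i | after {y'} i<y' with x ≟ i | y' ≟ suc i
    ... | yes refl | yes refl = begin
      lab (compose q i t) i (suc (suc i))  ≡⟨ compose-root q i t (sym i+2) (arc-compose arc) ⟩
      lab q i (suc i) ⋆ 𝟙                  ≡⟨ ⋆-identityʳ _ ⟩
      lab q i (suc i)                      ≡⟨ lab-deleteVertex i p (1≤i , n<1+n i , s≤s i≤k) ⟩
      lab p (up i i) (up i (suc i))        ≡⟨ cong₂ (lab p) (up-≤ {i} ≤-refl) (up-> (n<1+n i)) ⟩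
      lab p i (suc (suc i))                ∎
      where open ≡-Reasoning
    ... | no x≢i | _ = outer arc (inj₁ x≤i) (inj₂ (s≤s i<y')) (inj₁ (≤∧≢⇒< x≤i x≢i))
    ... | _ | no y'≢ = outer arc (inj₁ x≤i) (inj₂ (s≤s i<y')) (inj₂ (s≤s (≤∧≢⇒< i<y' (≢-sym y'≢))))
    decomposition x y arc@(1≤x , x<y , y≤) | apex | before y≤i = ⊥-elim (<-asym x<y (s≤s y≤i))
    decomposition x y arc@(1≤x , x<y , y≤) | apex | apex = ⊥-elim (<-irrefl refl x<y)
    decomposition x y arc@(1≤x , x<y , y≤) | apex | after {y'} i<y' with y' ≟ suc i
    ... | yes refl rewrite compose-inner q i t (arc-compose arc) (n≤1+n i) (≤-reflexive (sym i+2))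
                                         (inj₁ (λ e → <-irrefl (sym e) (n<1+n i)))
                         | m+n∸n≡m 1 i | m+n∸n≡m 2 i = refl
    ... | no y'≢ = trans (compose-crossing q i t (arc-compose arc)
                           (inj₂ (n<1+n i , subst (suc i <_) (sym i+2) (n<1+n (suc i)) ,
                                  subst (_< suc y') (sym i+2) (s≤s (≤∧≢⇒< i<y' (≢-sym y'≢))))))
                         (sym (ear-after (≤∧≢⇒< i<y' (≢-sym y'≢)) y≤))
    decomposition x y arc@(1≤x , x<y , y≤) | after i<x' | before y≤i =
      ⊥-elim (<-asym x<y (s≤s (≤-trans y≤i (<⇒≤ i<x'))))
    decomposition x y arc@(1≤x , x<y , y≤) | after i<x' | apex = ⊥-elim (<-asym x<y (s≤s i<x'))
    decomposition x y arc@(1≤x , x<y , y≤) | after i<x' | after i<y' =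
      outer arc (inj₂ (s≤s i<x')) (inj₂ (s≤s i<y')) (inj₂ (≤-<-trans (s≤s i<x') x<y))

  diagonal? : ∀ n x y → Dec (IsDiagonal n x y)
  diagonal? n x y = ((1 ≤? x) ×-dec (x <? y) ×-dec (y ≤? suc n))
               ×-dec ¬? (y ≟ suc x) ×-dec ¬? ((x ≟ 1) ×-dec (y ≟ suc n))

  crosses? : ∀ x y x' y' → Dec (Crosses x y x' y')
  crosses? x y x' y' = ((x <? x') ×-dec (x' <? y) ×-dec (y <? y'))
                ⊎-dec ((x' <? x) ×-dec (x <? y') ×-dec (y' <? y))

  crosses-sym : ∀ {x y x' y'} → Crosses x y x' y' → Crosses x' y' x y
  crosses-sym = swap

  module FreeVertex (n : ℕ) (S : ℕ → ℕ → Set) (S? : ∀ x y → Dec (S x y))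
                    (separated : ∀ {x y x' y'} → IsDiagonal n x y → IsDiagonal n x' y' →
                                 Crosses x y x' y' → S x y → S x' y' → ⊥) where

    Untouched : ℕ → Set
    Untouched v = ∀ z → (IsDiagonal n v z → ¬ S v z) × (IsDiagonal n z v → ¬ S z v)

    Frame : ℕ → ℕ → Set
    Frame a b = (a ≡ 1 × b ≡ suc n) ⊎ (IsDiagonal n a b × S a b)

    -- Strictly inside every frame lies an untouched vertex: either a+1 is
    -- untouched, or a diagonal (a+1 , z) ∈ S is a smaller frame; f bounds the
    -- width b - a of the frame.
    untouched-inside : ∀ f a b → b ≤ a + f → suc a < b → Frame a b →
      ∃ λ v → a < v × v < b × Untouched v
    untouched-inside zero a b b≤ a+1<b _ =
      ⊥-elim (<⇒≱ (<-trans (n<1+n a) a+1<b) (subst (b ≤_) (+-identityʳ a) b≤))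
    untouched-inside (suc f) a b b≤ a+1<b frame
      with anyUpTo? (λ z → (3 + a ≤? z) ×-dec diagonal? n (suc a) z ×-dec S? (suc a) z) (suc b)
    ... | yes (z , s≤s z≤b , a+2<z , d , s) =
      let (v , a+1<v , v<z , untouched) =
            untouched-inside f (suc a) z (≤-trans z≤b (subst (b ≤_) (+-suc a f) b≤)) a+2<z (inj₂ (d , s))
      in v , <-trans (n<1+n a) a+1<v , <-≤-trans v<z z≤b , untouched
    ... | no none = suc a , n<1+n a , a+1<b , λ z → outgoing frame z , incoming frame z
      where
        outgoing : Frame a b → ∀ z → IsDiagonal n (suc a) z → ¬ S (suc a) z
        outgoing frame z d@((_ , a+1<z , z≤) , notEdge , _) s with z ≤? b | frame
        ... | yes z≤b | _ = none (z , s≤s z≤b , ≤∧≢⇒< a+1<z (λ e → notEdge (sym e)) , d , s)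
        ... | no z≰b | inj₁ (_ , refl) = z≰b z≤
        ... | no z≰b | inj₂ (dab , sab) = separated dab d (inj₁ (n<1+n a , a+1<b , ≰⇒> z≰b)) sab s

        incoming : Frame a b → ∀ z → IsDiagonal n z (suc a) → ¬ S z (suc a)
        incoming frame z d@((1≤z , z<a+1 , _) , notEdge , _) s with frame
        ... | inj₁ (refl , _) = notEdge (cong suc (sym (≤-antisym (≤-pred z<a+1) 1≤z)))
        ... | inj₂ (dab , sab) =
          separated d dab (inj₁ (≤∧≢⇒< (≤-pred z<a+1) (λ e → notEdge (cong suc (sym e))) , n<1+n a , a+1<b))
                    s sab

    untouched-vertex : 2 ≤ n → ∃ λ v → 1 < v × v < suc n × Untouched v
    untouched-vertex 2≤n = untouched-inside (suc n) 1 (suc n) (n≤1+n (suc n)) (s≤s 2≤n) (inj₁ (refl , refl))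

  isLeft : {A B : Set} → A ⊎ B → Bool
  isLeft (inj₁ _) = true
  isLeft (inj₂ _) = false

  isLeft-true : {A B : Set} (s : A ⊎ B) → isLeft s ≡ true → A
  isLeft-true (inj₁ a) _ = a

  isLeft-false : {A B : Set} (s : A ⊎ B) → isLeft s ≡ false → B
  isLeft-false (inj₂ b) _ = b

  -- The witness nc names, for each
  -- crossing pair, one diagonal that is non-solid.  Asking it about a pair in
  -- both orders, (x , y) beats (x' , y') when it names (x' , y') both times;
  -- (x , y) is contested when some crossing diagonal is not beaten by it.
  -- Contested diagonals are non-solid, and uncontested ones do not cross.
  module SolidSupport (n : ℕ) (p : Clique n) (nc : NonCrossing n p) where

    answer : ∀ {x y x' y'} → Dec (IsDiagonal n x y) → Dec (IsDiagonal n x' y') → Dec (Crosses x y x' y') → Bool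
    answer (yes d) (yes d') (yes c) = isLeft (nc _ _ _ _ d d' c)
    answer _       _        _       = false

    answer-true : ∀ {x y x' y'} (d? : Dec (IsDiagonal n x y)) (d'? : Dec (IsDiagonal n x' y'))
      (c? : Dec (Crosses x y x' y')) → answer d? d'? c? ≡ true → lab p x y ≡ 𝟙
    answer-true (yes d) (yes d') (yes c) h = isLeft-true (nc _ _ _ _ d d' c) h

    answer-false : ∀ {x y x' y'} → IsDiagonal n x y → IsDiagonal n x' y' → Crosses x y x' y' →
      (d? : Dec (IsDiagonal n x y)) (d'? : Dec (IsDiagonal n x' y')) (c? : Dec (Crosses x y x' y')) →
      answer d? d'? c? ≡ false → lab p x' y' ≡ 𝟙
    answer-false _ _ _ (yes d) (yes d') (yes c) h = isLeft-false (nc _ _ _ _ d d' c) h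
    answer-false _ _ c (yes _) (yes _) (no ¬c) _ = ⊥-elim (¬c c)
    answer-false _ d' _ (yes _) (no ¬d') _ _ = ⊥-elim (¬d' d')
    answer-false d _ _ (no ¬d) _ _ _ = ⊥-elim (¬d d)

    -- Questions are asked with canonical (decided) proofs, so the answer only
    -- depends on the four vertices.
    declaresFirst : ℕ → ℕ → ℕ → ℕ → Bool
    declaresFirst x y x' y' = answer (diagonal? n x y) (diagonal? n x' y') (crosses? x y x' y')

    Beats : ℕ → ℕ → ℕ → ℕ → Set
    Beats x y x' y' = declaresFirst x y x' y' ≡ false × declaresFirst x' y' x y ≡ true

    beats? : ∀ x y x' y' → Dec (Beats x y x' y')
    beats? x y x' y' = (declaresFirst x y x' y' ≟ᵇ false) ×-dec (declaresFirst x' y' x y ≟ᵇ true)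

    Contested : ℕ → ℕ → Set
    Contested x y = ∃ λ x' → x' < suc (suc n) × ∃ λ y' → y' < suc (suc n) ×
      IsDiagonal n x' y' × Crosses x y x' y' × ¬ Beats x y x' y'

    contested? : ∀ x y → Dec (Contested x y)
    contested? x y = anyUpTo? (λ x' → anyUpTo? (λ y' →
      diagonal? n x' y' ×-dec crosses? x y x' y' ×-dec ¬? (beats? x y x' y')) (suc (suc n))) (suc (suc n))

    contested-unit : ∀ {x y} → IsDiagonal n x y → Contested x y → lab p x y ≡ 𝟙
    contested-unit {x} {y} d (x' , _ , y' , _ , d' , c , ¬beats)
      with declaresFirst x y x' y' in e₁ | declaresFirst x' y' x y in e₂
    ... | true  | _     = answer-true (diagonal? n x y) (diagonal? n x' y') (crosses? x y x' y') e₁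
    ... | false | false = answer-false d' d (crosses-sym c) (diagonal? n x' y') (diagonal? n x y) (crosses? x' y' x y) e₂
    ... | false | true  = ⊥-elim (¬beats (refl , refl))

    uncontested-beats : ∀ {x y x' y'} → ¬ Contested x y → IsDiagonal n x' y' → Crosses x y x' y' →
      Beats x y x' y'
    uncontested-beats {x} {y} {x'} {y'} unc d'@((_ , x'<y' , y'≤) , _) c =
      decidable-stable (beats? x y x' y')
        (λ ¬beats → unc (x' , <-trans x'<y' (s≤s y'≤) , y' , s≤s y'≤ , d' , c , ¬beats))

    uncontested-separated : ∀ {x y x' y'} → IsDiagonal n x y → IsDiagonal n x' y' → Crosses x y x' y' →
      ¬ Contested x y → ¬ Contested x' y' → ⊥
    uncontested-separated d d' c unc unc' with uncontested-beats unc d' c | uncontested-beats unc' d (crosses-sym c)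
    ... | (_ , declared) | (undeclared , _) with trans (sym declared) undeclared
    ... | ()

  ear-exists : ∀ n (p : Clique n) → 2 ≤ n → NonCrossing n p → ∃ λ v → 1 < v × v < suc n × Ear n p v
  ear-exists n p 2≤n nc =
    let (v , 1<v , v<n+1 , untouched) = untouched-vertex 2≤n
    in v , 1<v , v<n+1 ,
       λ z → (λ d → non-solid d (proj₁ (untouched z) d)) , (λ d → non-solid d (proj₂ (untouched z) d))
    where
      open SolidSupport n p nc
      open FreeVertex n (λ x y → ¬ Contested x y) (λ x y → ¬? (contested? x y)) uncontested-separated
      non-solid : ∀ {x y} → IsDiagonal n x y → ¬ ¬ Contested x y → lab p x y ≡ 𝟙
      non-solid {x} {y} d ¬¬contested = contested-unit d (decidable-stable (contested? x y) ¬¬contested)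

  no-diagonal₂ : ∀ {x y} → ¬ IsDiagonal 2 x y
  no-diagonal₂ {x} {y} ((1≤x , x<y , y≤3) , notEdge , notBase) = notBase (x≡1 , y≡3)
    where
      x+1<y : suc x < y
      x+1<y = ≤∧≢⇒< x<y (λ e → notEdge (sym e))
      x≡1 : x ≡ 1
      x≡1 = ≤-antisym (≤-pred (≤-pred (≤-trans x+1<y y≤3))) 1≤x
      y≡3 : y ≡ 3
      y≡3 = ≤-antisym y≤3 (subst (λ x → suc (suc x) ≤ y) x≡1 x+1<y)

  triangles-basis : Triangles ⊆ NCBasis
  triangles-basis .2 t refl = s≤s z≤n , (λ ()) , λ _ _ _ _ d _ _ → ⊥-elim (no-diagonal₂ d)

  generated-mono : ∀ {G H} → G ⊆ H → Generated G ⊆ Generated H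
  generated-mono G⊆H _ _ unit                = unit
  generated-mono G⊆H _ _ (gen g)             = gen (G⊆H _ _ g)
  generated-mono G⊆H _ _ (comp i 1≤i i≤n p q) =
    comp i 1≤i i≤n (generated-mono G⊆H _ _ p) (generated-mono G⊆H _ _ q)

  size-one : (p : Clique 1) → lab p 1 2 ≡ 𝟙 → p ≡ u
  size-one ((a ∷ []) , [] , tt) refl = refl

  module Generation (unital : IsUnitalMagma _≡_ _⋆_ 𝟙) where
    open IsUnitalMagma unital using () renaming (identityˡ to ⋆-identityˡ; identityʳ to ⋆-identityʳ)

    ear-step : ∀ k (p : Clique (suc k)) → 2 ≤ k → NonCrossing (suc k) p →
      (∀ q → NCBasis k q → Generated Triangles k q) → Generated Triangles (suc k) p
    ear-step k p 2≤k nc generate = from-ear (ear-exists (suc k) p (m≤n⇒m≤1+n 2≤k) nc)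
      where
        from-ear : (∃ λ v → 1 < v × v < suc (suc k) × Ear (suc k) p v) → Generated Triangles (suc k) p
        from-ear (suc i , s≤s 1≤i , s≤s (s≤s i≤k) , ear) =
          generated-relabel (comp i 1≤i i≤k (generate q q-basis) (gen {p = t} refl)) arity p decomposition
          where
            open EarDecomposition ⋆-identityʳ p 1≤i i≤k ear
            q-basis : NCBasis k q
            q-basis = ≤-trans (s≤s z≤n) 2≤k , (λ { refl → ⊥-elim (<-irrefl refl 2≤k) })
                    , deleteVertex-noncrossing i p nc

    triangles-generate : NCBasis ⊆ Generated Triangles
    triangles-generate zero    _ (() , _)
    triangles-generate 1       p (_ , unlabelled , _) =
      subst (Generated Triangles 1) (sym (size-one p (unlabelled refl))) unit
    triangles-generate 2       _ _ = gen refl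
    triangles-generate (suc (suc (suc k))) p (_ , _ , nc) =
      ear-step (suc (suc k)) p (s≤s (s≤s z≤n)) nc (triangles-generate (suc (suc k)))

    LowArity : Family → Family
    LowArity G zero                r = ⊥
    LowArity G 1                   r = r ≡ u
    LowArity G 2                   r = G 2 r
    LowArity G (suc (suc (suc _))) r = ⊤

    lowArity-high : ∀ G k r → 3 ≤ k → LowArity G k r
    lowArity-high G 1                   r (s≤s ())
    lowArity-high G 2                   r (s≤s (s≤s ()))
    lowArity-high G (suc (suc (suc _))) r _ = tt

    -- The unit laws of the operad in arities 1 and 2.
    -- (A size-2 clique is matched as the list of its labels (1,2), (1,3), (2,3),
    -- i.e. as triangle (1,2) (2,3) (1,3).)
    compose-u-u : compose {1} {1} u 1 u ≡ u
    compose-u-u = cong (λ a → (a ∷ []) , [] , tt) (⋆-identityˡ 𝟙)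

    compose-u-t : (t : Clique 2) → compose {1} {2} u 1 t ≡ t
    compose-u-t ((a ∷ b ∷ []) , (c ∷ []) , [] , tt) = cong (triangle a c) (⋆-identityˡ b)

    compose-t-u : ∀ i → 1 ≤ i → i ≤ 2 → (t : Clique 2) → compose {2} {1} t i u ≡ t
    compose-t-u 1 _ _ ((a ∷ b ∷ []) , (c ∷ []) , [] , tt) = cong (λ a → triangle a c b) (⋆-identityʳ a)
    compose-t-u 2 _ _ ((a ∷ b ∷ []) , (c ∷ []) , [] , tt) = cong (λ c → triangle a c b) (⋆-identityʳ c)
    compose-t-u (suc (suc (suc _))) _ (s≤s (s≤s ())) _

    module _ {G : Family} (G-basis : G ⊆ NCBasis) where

      generator-lowArity : G ⊆ LowArity G
      generator-lowArity zero                p g = ⊥-elim (<-irrefl refl (proj₁ (G-basis 0 p g)))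
      generator-lowArity 1                   p g = size-one p (proj₁ (proj₂ (G-basis 1 p g)) refl)
      generator-lowArity 2                   p g = g
      generator-lowArity (suc (suc (suc _))) p g = tt

      -- A composition landing in arity ≤ 2 has the unit as a factor.
      compose-lowArity : ∀ {n m p q} i → 1 ≤ i → i ≤ n → LowArity G n p → LowArity G m q →
        LowArity G (n + m ∸ 1) (compose p i q)
      compose-lowArity {zero} i 1≤i i≤0 _ _ = ⊥-elim (<-irrefl refl (≤-trans 1≤i i≤0))
      compose-lowArity {suc n} {zero} _ _ _ _ ()
      compose-lowArity {1} {1} 1 _ _ refl refl = compose-u-u
      compose-lowArity {1} {1} (suc (suc _)) _ (s≤s ()) _ _
      compose-lowArity {1} {2} {q = q} 1 _ _ refl g = subst (G 2) (sym (compose-u-t q)) g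
      compose-lowArity {1} {2} (suc (suc _)) _ (s≤s ()) _ _
      compose-lowArity {1} {suc (suc (suc _))} _ _ _ _ _ = tt
      compose-lowArity {2} {1} {p = p} i 1≤i i≤2 g refl = subst (G 2) (sym (compose-t-u i 1≤i i≤2 p)) g
      compose-lowArity {2} {suc (suc _)} _ _ _ _ _ = tt
      compose-lowArity {suc (suc (suc n))} {suc m} {p} {q} i _ _ _ _ =
        lowArity-high G _ (compose p i q) (s≤s (s≤s (subst (1 ≤_) (sym (+-suc n m)) (s≤s z≤n))))

      generated-lowArity : Generated G ⊆ LowArity G
      generated-lowArity _ _ unit = refl
      generated-lowArity n p (gen g) = generator-lowArity n p g
      generated-lowArity _ _ (comp i 1≤i i≤n gp gq) =
        compose-lowArity i 1≤i i≤n (generated-lowArity _ _ gp) (generated-lowArity _ _ gq)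

    triangles-necessary : ∀ G → IsGeneratingSet G → Triangles ⊆ G
    triangles-necessary G (G-basis , G-generates) .2 t refl =
      generated-lowArity G-basis 2 t (G-generates 2 t (triangles-basis 2 t refl))

    triangles-minimal : IsMinimalGeneratingSet Triangles
    triangles-minimal = (triangles-basis , triangles-generate) , λ H _ H-generating → triangles-necessary H H-generating

    -- … and every minimal generating set G equals it: G ∩ Triangles still
    -- generates, so by minimality G ⊆ Triangles.
    minimal⇒triangles : ∀ G → IsMinimalGeneratingSet G → (G ⊆ Triangles) × (Triangles ⊆ G)
    minimal⇒triangles G ((G-basis , G-generates) , G-minimal) = G⊆T , T⊆G
      where
        T⊆G : Triangles ⊆ G
        T⊆G = triangles-necessary G (G-basis , G-generates)
        G∩T : Family
        G∩T n p = G n p × Triangles n p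
        G∩T-generating : IsGeneratingSet G∩T
        G∩T-generating = (λ n p h → G-basis n p (proj₁ h))
                       , (λ n p b → generated-mono (λ n p t → T⊆G n p t , t) n p (triangles-generate n p b))
        G⊆T : G ⊆ Triangles
        G⊆T n p g = proj₂ (G-minimal G∩T (λ _ _ → proj₁) G∩T-generating n p g)

proposition3p1 : (M : Set) (_⋆_ : M → M → M) (𝟙 : M) → IsUnitalMagma _≡_ _⋆_ 𝟙 →
    Cliques.IsUniqueMinimalGeneratingSet M _⋆_ 𝟙 (Cliques.Triangles M _⋆_ 𝟙)
proposition3p1 M _⋆_ 𝟙 unital = triangles-minimal , minimal⇒triangles
  where open Development.Generation M _⋆_ 𝟙 unital
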